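{- If $N$ is a minor of a matroid $M$, then the branch-depth of $N$ is less than or equal to the branch-depth of $M$.
   Context: For a matroid $M$ with rank function $r$ on ground set $E$, $\lambda_M(X)=r(X)+r(E\setminus X)-r(E)$. A decomposition of $\lambda_M$ is a pair $(T,\sigma)$ with $T$ a tree having at least one internal node and $\sigma$ a bijection from $E$ to the leaves of $T$; for an internal node $v$ the components of $T-v$ induce a partition $\mathcal P_v$ of $E$, and the width of $v$ is $\max_{\mathcal P'\subseteq\mathcal P_v}\lambda_M(\bigcup_{X\in\mathcal P'}X)$; the width of $(T,\sigma)$ is the maximum width of an internal node and its radius is the minimum $r$ such that some node of $T$ is within distance $r$ of every node. The branch-depth of $M$ is the minimum $k$ such that a decomposition of width $\le k$ and radius $\le k$ exists, and is $0$ if $|E|<2$. -}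

module Defs where

open import Data.Nat using (ℕ; zero; suc; _+_; _∸_; _≤_; _<_; _≥_)
open import Data.Bool using (Bool; true; false; T; if_then_else_; _∧_; not)
open import Data.Fin using (Fin; zero; suc; _≟_)
open import Data.Fin.Subset using (Subset; _∈_; _∉_; _⊆_; _∪_; _∩_; ∁; ⊤; ⊥; ⁅_⁆; ∣_∣)
open import Data.Vec using (_∷_; []; tabulate)
open import Data.List using (List; length; _∷_; [])
open import Data.List.Relation.Unary.Unique.Propositional using (Unique)
open import Data.Product using (Σ; ∃; _×_; _,_)
open import Data.Sum using (_⊎_)
open import Relation.Binary.PropositionalEquality using (_≡_; _≢_)
open import Relation.Nullary using (¬_)
open import Relation.Nullary.Decidable using (⌊_⌋)
open import Function using (_∘_; _⇔_)
open import Function.Definitions using (Injective)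

record Matroid (n : ℕ) : Set where
  field
    rank       : Subset n → ℕ
    rank-card  : ∀ X → rank X ≤ ∣ X ∣
    rank-mono  : ∀ {X Y} → X ⊆ Y → rank X ≤ rank Y
    rank-submod : ∀ X Y → rank (X ∪ Y) + rank (X ∩ Y) ≤ rank X + rank Y
open Matroid public

conn : ∀ {n} → Matroid n → Subset n → ℕ
conn M X = (rank M X + rank M (∁ X)) ∸ rank M ⊤

img : ∀ {m n} → (Fin m → Fin n) → Subset m → Subset n
img {zero}  f []      = ⊥
img {suc m} f (b ∷ X) = (if b then ⁅ f zero ⁆ else ⊥) ∪ img (f ∘ suc) X

-- N is (isomorphic to) M / C ∖ D where D is the complement of C ∪ f(E(N)):
-- f identifies E(N) with E(M) ∖ (C ∪ D), and
-- r_N(X) = r_M(X ∪ C) − r_M(C).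
IsMinor : ∀ {m n} → Matroid m → Matroid n → Set
IsMinor {m} {n} N M =
  Σ (Fin m → Fin n) λ f → Σ (Subset n) λ C →
    Injective _≡_ _≡_ f ×
    (∀ i → f i ∉ C) ×
    (∀ X → rank N X ≡ rank M (img f X ∪ C) ∸ rank M C)

data Walk {t : ℕ} (adj : Fin t → Fin t → Bool) : Fin t → Fin t → ℕ → Set where
  here : ∀ {x} → Walk adj x x 0
  step : ∀ {x y z k} → T (adj x y) → Walk adj y z k → Walk adj x z (suc k)

data Path {t : ℕ} (adj : Fin t → Fin t → Bool) : List (Fin t) → Set where
  single : ∀ {x} → Path adj (x ∷ [])
  cons   : ∀ {x y xs} → T (adj x y) → Path adj (y ∷ xs) → Path adj (x ∷ y ∷ xs)

lastOf : ∀ {A : Set} → A → List A → A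
lastOf a []       = a
lastOf a (b ∷ bs) = lastOf b bs

IsCycle : ∀ {t} → (Fin t → Fin t → Bool) → List (Fin t) → Set
IsCycle adj [] = Data.Empty.⊥ where import Data.Empty
IsCycle adj (x ∷ xs) =
  3 ≤ length (x ∷ xs) × Unique (x ∷ xs) × Path adj (x ∷ xs) × T (adj (lastOf x xs) x)

record Tree (t : ℕ) : Set where
  field
    adj       : Fin t → Fin t → Bool
    adj-sym   : ∀ x y → adj x y ≡ adj y x
    adj-irr   : ∀ x → adj x x ≡ false
    connected : ∀ x y → ∃ λ k → Walk adj x y k
    acyclic   : ∀ cs → ¬ IsCycle adj cs
open Tree public

degree : ∀ {t} → Tree t → Fin t → ℕ
degree Tr v = ∣ tabulate (adj Tr v) ∣

IsLeaf : ∀ {t} → Tree t → Fin t → Set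
IsLeaf Tr v = degree Tr v ≡ 1

IsInternal : ∀ {t} → Tree t → Fin t → Set
IsInternal Tr v = ¬ IsLeaf Tr v

adjMinus : ∀ {t} → Tree t → Fin t → Fin t → Fin t → Bool
adjMinus Tr v x y = adj Tr x y ∧ not ⌊ x ≟ v ⌋ ∧ not ⌊ y ≟ v ⌋

SameComp : ∀ {t} → Tree t → Fin t → Fin t → Fin t → Set
SameComp Tr v x y = ∃ λ k → Walk (adjMinus Tr v) x y k

record Decomposition {n : ℕ} (M : Matroid n) : Set where
  field
    size     : ℕ
    tree     : Tree size
    σ        : Fin n → Fin size
    σ-inj    : Injective _≡_ _≡_ σ
    σ-leaf   : ∀ e → IsLeaf tree (σ e)
    σ-onto   : ∀ v → IsLeaf tree v → ∃ λ e → σ e ≡ v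
    internal : ∃ λ v → IsInternal tree v
open Decomposition public

UnionOfParts : ∀ {n} {M : Matroid n} (D : Decomposition M) → Fin (size D) → Subset n → Set
UnionOfParts D v X =
  ∀ e e' → SameComp (tree D) v (σ D e) (σ D e') → e ∈ X → e' ∈ X

NodeWidth≤ : ∀ {n} {M : Matroid n} (D : Decomposition M) → Fin (size D) → ℕ → Set
NodeWidth≤ {M = M} D v k = ∀ X → UnionOfParts D v X → conn M X ≤ k

Width≤ : ∀ {n} {M : Matroid n} → Decomposition M → ℕ → Set
Width≤ D k = ∀ v → IsInternal (tree D) v → NodeWidth≤ D v k

Radius≤ : ∀ {n} {M : Matroid n} → Decomposition M → ℕ → Set
Radius≤ D k = ∃ λ c → ∀ v → ∃ λ j → j ≤ k × Walk (adj (tree D)) c v j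


IsBranchDepth : ∀ {n} → Matroid n → ℕ → Set
IsBranchDepth {n} M b =
  ((n < 2) × b ≡ 0) ⊎
  ((2 ≤ n) × (∃ λ (D : Decomposition M) → Width≤ D b × Radius≤ D b) ×
   (∀ k → (∃ λ (D : Decomposition M) → Width≤ D k × Radius≤ D k) → b ≤ k))

-- Take a decomposition (T, σ) of M witnessing its branch-depth b and label only the
-- elements of N. Connectivity can only drop in a minor: if Y ⊆ E(M) meets the copy of
-- E(N) exactly in X, then λ_N(X) ≤ λ_M(Y), by four applications of submodularity. For an
-- internal node v, a union X of blocks of the partition of E(N) extends to the union Y of
-- those blocks of the partition of E(M) that meet X, so v still has width ≤ b. Unlabelled
-- leaves are then pruned one at a time: a leaf lies on no path between two other nodes,
-- so no component structure among labelled leaves and no distance grows, and the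
-- resulting decomposition of N has width and radius ≤ b.
module Submission where

open import Defs
open import Data.Nat using (ℕ; zero; suc; _+_; _∸_; _≤_; _<_; z≤n; s≤s)
import Data.Nat as ℕ
open import Data.Nat.Properties
  using (≤-refl; ≤-trans; ≤-antisym; <-irrefl; +-comm; +-mono-≤; +-monoˡ-≤; +-cancelˡ-≤;
         +-cancelʳ-≤; m≤m+n; m≤n⇒m≤1+n; n≤1+n; ∸-monoˡ-≤; ∸-+-assoc; m+n≤o⇒m≤o∸n; m+n∸m≡n;
         [m+n]∸[m+o]≡n∸o; m≤n⇒∃[o]m+o≡n; module ≤-Reasoning)
open import Data.Nat.Tactic.RingSolver using (solve-∀)
open import Data.Bool using (Bool; true; false; T; _∧_; not)
open import Data.Bool.Properties using (T?; T-≡; T-∧; ∧-comm)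
open import Data.Fin using (Fin; zero; suc; punchIn; punchOut; _≟_)
open import Data.Fin.Properties
  using (any?; all?; ¬∀⟶∃¬; injective⇒≤; punchIn-injective; punchInᵢ≢i; punchIn-punchOut;
         punchOut-injective)
open import Data.Fin.Subset using (Subset; _∈_; _∉_; _⊆_; _∪_; _∩_; ∁; ⊤; ∣_∣; _-_; Nonempty)
open import Data.Fin.Subset.Properties
  using (_∈?_; drop-there; x∈⁅x⁆; x∈⁅y⁆⇒x≡y; x≢y⇒x∉⁅y⁆; ∈⊤; x∈p∪q⁺; x∈p∪q⁻; x∈p∩q⁺;
         p⊆p∪q; q⊆p∪q; p∩q⊆p; p∩q⊆q; ⊆-trans; x∈∁p⇒x∉p; x∉p⇒x∈∁p; ∣p∣≤∣x∷p∣;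
         x∈p⇒∣p-x∣<∣p∣; x∈p∧x∉q⇒x∈p─q; nonempty?; Empty-unique; ∣⊥∣≡0; ∉⊥)
open import Data.Vec using (_∷_; []; tabulate; here; there)
open import Data.Vec.Properties using (lookup∘tabulate; lookup⇒[]=; []=⇒lookup)
open import Data.List using (_∷_; []; map)
open import Data.List.Properties using (length-map)
open import Data.List.Relation.Unary.Unique.Propositional.Properties using (map⁺)
open import Data.Product using (Σ; ∃; _×_; _,_; proj₁; proj₂)
open import Data.Sum using (_⊎_; inj₁; inj₂; [_,_])
open import Data.Empty using (⊥-elim)
open import Relation.Binary.PropositionalEquality using (_≡_; _≢_; refl; sym; trans; cong; cong₂; subst; subst₂)
open import Relation.Nullary using (¬_; Dec; yes; no)
open import Relation.Nullary.Decidable using (⌊_⌋; ¬?; _×-dec_; toWitness; fromWitness)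
open import Relation.Nullary.Negation using (contradiction)
open import Function using (_∘_)
open import Function.Bundles using (Equivalence)
open import Function.Definitions using (Injective)

private
  variable
    m n t k l : ℕ

Graph : ℕ → Set
Graph t = Fin t → Fin t → Bool

private
  variable
    g h : Graph t
    a b c : Fin t

Reachable : Graph t → Fin t → Fin t → Set
Reachable g a b = ∃ λ k → Walk g a b k

SymmetricGraph : Graph t → Set
SymmetricGraph g = ∀ {p q} → T (g p q) → T (g q p)

_∖ᵛ_ : Graph (suc t) → Fin (suc t) → Graph t
(g ∖ᵛ x) p q = g (punchIn x p) (punchIn x q)

-- For symmetric g: x has at most one neighbour.
Pendant : Graph t → Fin t → Set
Pendant g x = ∀ {p q} → T (g p x) → T (g x q) → p ≡ q

Walk-map : (∀ {p q} → T (g p q) → T (h p q)) → Walk g a b k → Walk h a b k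
Walk-map F here       = here
Walk-map F (step e w) = step (F e) (Walk-map F w)

_++ʷ_ : Walk g a b k → Walk g b c l → Walk g a c (k + l)
here     ++ʷ w = w
step e v ++ʷ w = step e (v ++ʷ w)

Walk-reverse : SymmetricGraph g → Walk g a b k → Walk g b a k
Walk-reverse g-sym here = here
Walk-reverse {g = g} g-sym (step {k = k} e w) =
  subst (Walk g _ _) (+-comm k 1) (Walk-reverse g-sym w ++ʷ step (g-sym e) here)

Walk-punchIn : ∀ (x : Fin (suc t)) {i j} → Walk (g ∖ᵛ x) i j k → Walk g (punchIn x i) (punchIn x j) k
Walk-punchIn x here       = here
Walk-punchIn x (step e w) = step e (Walk-punchIn x w)

Walk-0⇒≡ : Walk g a b 0 → a ≡ b
Walk-0⇒≡ here = refl

Walk-bypass : ∀ (x : Fin (suc t)) → Pendant g x → Walk g a b k → ∀ i j →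
              a ≡ punchIn x i → b ≡ punchIn x j → ∃ λ k′ → k′ ≤ k × Walk (g ∖ᵛ x) i j k′
Walk-bypass x pendant here i j a≡ b≡ with punchIn-injective x i j (trans (sym a≡) b≡)
... | refl = 0 , z≤n , here
Walk-bypass x pendant (step {y = c} e w) i j a≡ b≡ with c ≟ x
Walk-bypass x pendant (step e here) i j a≡ b≡ | yes refl = ⊥-elim (punchInᵢ≢i x j (sym b≡))
Walk-bypass x pendant (step e (step e′ w)) i j a≡ b≡ | yes refl
  with Walk-bypass x pendant w i j (trans (sym (pendant e e′)) a≡) b≡
... | k′ , k′≤ , w′ = k′ , m≤n⇒m≤1+n (m≤n⇒m≤1+n k′≤) , w′
Walk-bypass {g = g} x pendant (step e w) i j a≡ b≡ | no c≢x
  with Walk-bypass x pendant w (punchOut (c≢x ∘ sym)) j (sym (punchIn-punchOut (c≢x ∘ sym))) b≡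
... | k′ , k′≤ , w′ =
  suc k′ , s≤s k′≤ , step (subst₂ (λ p q → T (g p q)) a≡ (sym (punchIn-punchOut (c≢x ∘ sym))) e) w′

Path-punchIn : ∀ (x : Fin (suc t)) {vs} → Path (g ∖ᵛ x) vs → Path g (map (punchIn x) vs)
Path-punchIn x single     = single
Path-punchIn x (cons e p) = cons e (Path-punchIn x p)

lastOf-map : ∀ {A B : Set} (f : A → B) a as → lastOf (f a) (map f as) ≡ f (lastOf a as)
lastOf-map f a []       = refl
lastOf-map f a (b ∷ bs) = lastOf-map f b bs

Walk-lastVisit : ∀ (x : Fin (suc t)) j → Walk g a b k → b ≡ punchIn x j →
                 (∃ λ c → T (g x (punchIn x c)) × Reachable (g ∖ᵛ x) c j)
                 ⊎ (∃ λ i → a ≡ punchIn x i × Reachable (g ∖ᵛ x) i j)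
Walk-lastVisit x j here b≡ = inj₂ (j , b≡ , 0 , here)
Walk-lastVisit x j (step e w) b≡ with Walk-lastVisit x j w b≡
... | inj₁ viaNeighbour = inj₁ viaNeighbour
Walk-lastVisit {g = g} {a = a} x j (step e w) b≡ | inj₂ (i , c≡ , k′ , w′) with a ≟ x
... | yes refl = inj₁ (i , subst (T ∘ g x) c≡ e , k′ , w′)
... | no a≢x = inj₂ (punchOut (a≢x ∘ sym) , sym (punchIn-punchOut (a≢x ∘ sym)) , suc k′ ,
                     step (subst₂ (λ p q → T (g p q)) (sym (punchIn-punchOut (a≢x ∘ sym))) c≡ e) w′)

reachable? : ∀ (g : Graph t) a b → Dec (Reachable g a b)
reachable? {zero} g () b
reachable? {suc t} g a b with a ≟ b
... | yes refl = yes (0 , here)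
... | no a≢b with any? (λ c → T? (g a (punchIn a c)) ×-dec reachable? (g ∖ᵛ a) c (punchOut a≢b))
...   | yes (c , e , k , w) =
  yes (suc k , step e (subst (λ z → Walk g (punchIn a c) z k) (punchIn-punchOut a≢b) (Walk-punchIn a w)))
...   | no ¬viaNeighbour = no λ { (k , w) →
  [ ¬viaNeighbour , (λ { (i , a≡ , _) → punchInᵢ≢i a i (sym a≡) }) ]
    (Walk-lastVisit a (punchOut a≢b) w (sym (punchIn-punchOut a≢b))) }

∈-tabulate⁺ : ∀ {p : Fin n → Bool} {x} → T (p x) → x ∈ tabulate p
∈-tabulate⁺ {p = p} {x} px = lookup⇒[]= x (tabulate p) (trans (lookup∘tabulate p x) (Equivalence.to T-≡ px))

∈-tabulate⁻ : ∀ {p : Fin n → Bool} {x} → x ∈ tabulate p → T (p x)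
∈-tabulate⁻ {p = p} {x} x∈ = Equivalence.from T-≡ (trans (sym (lookup∘tabulate p x)) ([]=⇒lookup x∈))

x∈p⇒0<∣p∣ : ∀ {p : Subset n} {x} → x ∈ p → 0 < ∣ p ∣
x∈p⇒0<∣p∣ x∈p = ≤-trans (s≤s z≤n) (x∈p⇒∣p-x∣<∣p∣ x∈p)

0<∣p∣⇒nonempty : ∀ {p : Subset n} → 0 < ∣ p ∣ → Nonempty p
0<∣p∣⇒nonempty {n} {p} 0<∣p∣ with nonempty? p
... | yes p≢∅ = p≢∅
... | no p≡∅ = contradiction (subst (λ q → 0 < ∣ q ∣) (Empty-unique p≡∅) 0<∣p∣) (<-irrefl (sym (∣⊥∣≡0 n)))

∣p∣≡1⇒≡ : ∀ {p : Subset n} {x y} → ∣ p ∣ ≡ 1 → x ∈ p → y ∈ p → x ≡ y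
∣p∣≡1⇒≡ {p = p} {x} {y} ∣p∣≡1 x∈p y∈p with x ≟ y
... | yes x≡y = x≡y
... | no x≢y = contradiction
  (≤-trans (s≤s (x∈p⇒0<∣p∣ (x∈p∧x∉q⇒x∈p─q y∈p (x≢y⇒x∉⁅y⁆ (x≢y ∘ sym)))))
           (subst (∣ p - x ∣ <_) ∣p∣≡1 (x∈p⇒∣p-x∣<∣p∣ x∈p)))
  λ { (s≤s ()) }

∣tabulate∘punchIn∣≤∣tabulate∣ : ∀ (p : Fin (suc n) → Bool) x → ∣ tabulate (p ∘ punchIn x) ∣ ≤ ∣ tabulate p ∣
∣tabulate∘punchIn∣≤∣tabulate∣ p zero = ∣p∣≤∣x∷p∣ (p zero) (tabulate (p ∘ suc))
∣tabulate∘punchIn∣≤∣tabulate∣ {suc n} p (suc x) with p zero | ∣tabulate∘punchIn∣≤∣tabulate∣ (p ∘ suc) x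
... | true  | ≤tail = s≤s ≤tail
... | false | ≤tail = ≤tail

module _ (Tr : Tree t) where

  adj-symᵀ : T (adj Tr a b) → T (adj Tr b a)
  adj-symᵀ {a = a} {b} = subst T (adj-sym Tr a b)

  adj⇒≢ : T (adj Tr a b) → a ≢ b
  adj⇒≢ {a = a} e refl = subst T (adj-irr Tr a) e

  adjMinus⇒adj : ∀ {v} → T (adjMinus Tr v a b) → T (adj Tr a b)
  adjMinus⇒adj = proj₁ ∘ Equivalence.to T-∧

  adjMinus-sym : ∀ v → SymmetricGraph (adjMinus Tr v)
  adjMinus-sym v {p} {q} =
    subst T (cong₂ _∧_ (adj-sym Tr p q) (∧-comm (not ⌊ p ≟ v ⌋) (not ⌊ q ≟ v ⌋)))

  ≢⇒0<degree : a ≢ b → 0 < degree Tr a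
  ≢⇒0<degree {a = a} {b} a≢b with connected Tr a b
  ... | _ , here     = contradiction refl a≢b
  ... | _ , step e _ = x∈p⇒0<∣p∣ (∈-tabulate⁺ {p = adj Tr a} e)

  leaf-neighbour : IsLeaf Tr a → ∃ λ b → T (adj Tr a b)
  leaf-neighbour {a = a} a-leaf with 0<∣p∣⇒nonempty {p = tabulate (adj Tr a)} (subst (0 <_) (sym a-leaf) ≤-refl)
  ... | b , b∈ = b , ∈-tabulate⁻ b∈

  leaf-pendant : IsLeaf Tr a → Pendant (adj Tr) a
  leaf-pendant a-leaf p q = ∣p∣≡1⇒≡ a-leaf (∈-tabulate⁺ (adj-symᵀ p)) (∈-tabulate⁺ q)

  leaf-pendant-adjMinus : IsLeaf Tr a → ∀ v → Pendant (adjMinus Tr v) a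
  leaf-pendant-adjMinus a-leaf v p q = leaf-pendant a-leaf (adjMinus⇒adj p) (adjMinus⇒adj q)

  adjacent-leaves-closed : IsLeaf Tr a → IsLeaf Tr b → T (adj Tr a b) →
                           ∀ {u z} → Walk (adj Tr) u z k → u ≡ a ⊎ u ≡ b → z ≡ a ⊎ z ≡ b
  adjacent-leaves-closed a-leaf b-leaf ab here u∈ = u∈
  adjacent-leaves-closed a-leaf b-leaf ab (step e w) (inj₁ refl) =
    adjacent-leaves-closed a-leaf b-leaf ab w (inj₂ (sym (leaf-pendant a-leaf (adj-symᵀ ab) e)))
  adjacent-leaves-closed a-leaf b-leaf ab (step e w) (inj₂ refl) =
    adjacent-leaves-closed a-leaf b-leaf ab w (inj₁ (sym (leaf-pendant b-leaf ab e)))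

fresh-vertex : ∀ (b : Fin (3 + t)) → ∃ λ z → z ≢ zero × z ≢ b
fresh-vertex zero          = suc zero , (λ ()) , (λ ())
fresh-vertex (suc zero)    = suc (suc zero) , (λ ()) , (λ ())
fresh-vertex (suc (suc b)) = suc zero , (λ ()) , (λ ())

internal-exists : (Tr : Tree t) → 3 ≤ t → ∃ (IsInternal Tr)
internal-exists {t} Tr 3≤t with all? (λ v → degree Tr v ℕ.≟ 1)
... | no ¬allLeaves = ¬∀⟶∃¬ t _ (λ v → degree Tr v ℕ.≟ 1) ¬allLeaves
internal-exists Tr (s≤s (s≤s (s≤s _))) | yes allLeaves with leaf-neighbour Tr (allLeaves zero)
... | b , 0b with fresh-vertex b
...   | z , z≢0 , z≢b with connected Tr zero z
...     | _ , w = ⊥-elim ([ z≢0 , z≢b ]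
  (adjacent-leaves-closed Tr (allLeaves zero) (allLeaves b) 0b w (inj₁ refl)))

Centre : Tree t → Fin t → ℕ → Set
Centre Tr c k = ∀ v → ∃ λ j → j ≤ k × Walk (adj Tr) c v j

module _ (Tr : Tree (suc t)) {x : Fin (suc t)} (x-leaf : IsLeaf Tr x) where

  removeLeaf : Tree t
  removeLeaf = record
    { adj       = adj Tr ∖ᵛ x
    ; adj-sym   = λ p q → adj-sym Tr (punchIn x p) (punchIn x q)
    ; adj-irr   = λ p → adj-irr Tr (punchIn x p)
    ; connected = connected′
    ; acyclic   = acyclic′
    }
    where
    connected′ : ∀ p q → Reachable (adj Tr ∖ᵛ x) p q
    connected′ p q with proj₂ (connected Tr (punchIn x p) (punchIn x q))
    ... | w with Walk-bypass x (leaf-pendant Tr x-leaf) w p q refl refl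
    ... | k , _ , w = k , w

    acyclic′ : ∀ cs → ¬ IsCycle (adj Tr ∖ᵛ x) cs
    acyclic′ (c ∷ cs) (3≤length , unique , path , closing) = acyclic Tr (map (punchIn x) (c ∷ cs))
      ( subst (3 ≤_) (sym (length-map (punchIn x) (c ∷ cs))) 3≤length
      , map⁺ (punchIn-injective x _ _) unique
      , Path-punchIn x path
      , subst (λ z → T (adj Tr z (punchIn x c))) (sym (lastOf-map (punchIn x) c cs)) closing )

  removeLeaf-leaf : 3 ≤ t → ∀ {v} → IsLeaf Tr (punchIn x v) → IsLeaf removeLeaf v
  removeLeaf-leaf (s≤s (s≤s (s≤s _))) {v} v-leaf = ≤-antisym
    (subst (degree removeLeaf v ≤_) v-leaf (∣tabulate∘punchIn∣≤∣tabulate∣ (adj Tr (punchIn x v)) x))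
    (≢⇒0<degree removeLeaf (proj₂ (proj₂ (fresh-vertex v)) ∘ sym))

  adjMinus-punchIn : ∀ v p q → adjMinus Tr (punchIn x v) (punchIn x p) (punchIn x q) ≡ adjMinus removeLeaf v p q
  adjMinus-punchIn v p q =
    cong₂ (λ u w → adj Tr (punchIn x p) (punchIn x q) ∧ not u ∧ not w) (does-punchIn p v) (does-punchIn q v)
    where
    does-punchIn : ∀ i j → ⌊ punchIn x i ≟ punchIn x j ⌋ ≡ ⌊ i ≟ j ⌋
    does-punchIn i j with i ≟ j | punchIn x i ≟ punchIn x j
    ... | yes _   | yes _  = refl
    ... | no _    | no _   = refl
    ... | yes i≡j | no ≢   = contradiction (cong (punchIn x) i≡j) ≢
    ... | no i≢j  | yes ≡′ = contradiction (punchIn-injective x i j ≡′) i≢j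

  removeLeaf-sameComp : ∀ {v p q} → SameComp Tr (punchIn x v) (punchIn x p) (punchIn x q) → SameComp removeLeaf v p q
  removeLeaf-sameComp {v} {p} {q} (k , w)
    with Walk-bypass x (leaf-pendant-adjMinus Tr x-leaf (punchIn x v)) w p q refl refl
  ... | k′ , _ , w′ = k′ , Walk-map (λ {i} {j} → subst T (adjMinus-punchIn v i j)) w′

  removeLeaf-distance≤ : ∀ {a i v} → a ≡ punchIn x i → (∃ λ j → j ≤ k × Walk (adj Tr) a (punchIn x v) j) →
                         ∃ λ j → j ≤ k × Walk (adj removeLeaf) i v j
  removeLeaf-distance≤ a≡ (j , j≤k , w) with Walk-bypass x (leaf-pendant Tr x-leaf) w _ _ a≡ refl
  ... | j′ , j′≤j , w′ = j′ , ≤-trans j′≤j j≤k , w′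

  removeLeaf-centre : ∀ {c} → Centre Tr c k → ∃ λ c′ → Centre removeLeaf c′ k
  removeLeaf-centre {k} {c} centre with c ≟ x
  ... | no c≢x = punchOut (c≢x ∘ sym) , λ v →
    removeLeaf-distance≤ (sym (punchIn-punchOut (c≢x ∘ sym))) (centre (punchIn x v))
  ... | yes refl with leaf-neighbour Tr x-leaf
  ...   | y , xy = punchOut (adj⇒≢ Tr xy) , λ v → viaNeighbour v (centre (punchIn x v))
    where
    viaNeighbour : ∀ v → (∃ λ j → j ≤ k × Walk (adj Tr) x (punchIn x v) j) →
                   ∃ λ j → j ≤ k × Walk (adj removeLeaf) (punchOut (adj⇒≢ Tr xy)) v j
    viaNeighbour v (zero , _ , w) = ⊥-elim (punchInᵢ≢i x v (sym (Walk-0⇒≡ w)))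
    viaNeighbour v (suc j , 1+j≤k , step e w) = removeLeaf-distance≤
      (trans (leaf-pendant Tr x-leaf (adj-symᵀ Tr e) xy) (sym (punchIn-punchOut (adj⇒≢ Tr xy))))
      (j , ≤-trans (n≤1+n j) 1+j≤k , w)

img⁺ : ∀ (f : Fin m → Fin n) {X x} → x ∈ X → f x ∈ img f X
img⁺ f {true ∷ X} {zero} _     = x∈p∪q⁺ (inj₁ (x∈⁅x⁆ (f zero)))
img⁺ f {_ ∷ X}    {suc x} x∈X  = x∈p∪q⁺ (inj₂ (img⁺ (f ∘ suc) (drop-there x∈X)))

img⁻ : ∀ (f : Fin m → Fin n) {X y} → y ∈ img f X → ∃ λ x → x ∈ X × f x ≡ y
img⁻ {zero}  f {[]}    y∈ = ⊥-elim (∉⊥ y∈)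
img⁻ {suc m} f {b ∷ X} y∈ with b | x∈p∪q⁻ _ (img (f ∘ suc) X) y∈
... | true  | inj₁ y∈⁅f0⁆ = zero , here , sym (x∈⁅y⁆⇒x≡y (f zero) y∈⁅f0⁆)
... | false | inj₁ y∈⊥    = ⊥-elim (∉⊥ y∈⊥)
... | _     | inj₂ y∈rest with img⁻ (f ∘ suc) y∈rest
...   | x , x∈X , fx≡y = suc x , there x∈X , fx≡y

img-⊆ : ∀ (f : Fin m → Fin n) {X W} → (∀ {x} → x ∈ X → f x ∈ W) → img f X ⊆ W
img-⊆ f f∈W y∈ with img⁻ f y∈
... | x , x∈X , refl = f∈W x∈X

∪-least : ∀ {p q r : Subset n} → p ⊆ r → q ⊆ r → p ∪ q ⊆ r
∪-least {p = p} {q} p⊆r q⊆r = [ p⊆r , q⊆r ] ∘ x∈p∪q⁻ p q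

∩-greatest : ∀ {p q r : Subset n} → r ⊆ p → r ⊆ q → r ⊆ p ∩ q
∩-greatest r⊆p r⊆q x∈r = x∈p∩q⁺ (r⊆p x∈r , r⊆q x∈r)

module _ (M : Matroid n) where

  private
    r = rank M

  rank-separated-≤ : ∀ {A B C S W} → A ⊆ W ∩ S → B ⊆ ∁ W ∩ S → C ⊆ S →
                     r (A ∪ C) + r (B ∪ C) + r ⊤ ≤ r C + r S + (r W + r (∁ W))
  rank-separated-≤ {A} {B} {C} {S} {W} A⊆ B⊆ C⊆S =
    linear-combination (r (A ∪ C)) (r (B ∪ C)) (r ⊤) (r C) (r S) (r W) (r (∁ W))
      (r ((W ∩ S) ∩ C)) (r (W ∪ S)) (r (W ∩ S)) (r (∁ W ∩ S))
      A∪C-bound B∪C-bound (rank-submod M W S) ⊤-bound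
    where
    C⊆sides : C ⊆ (∁ W ∩ S) ∪ ((W ∩ S) ∩ C)
    C⊆sides {z} z∈C with z ∈? W
    ... | yes z∈W = x∈p∪q⁺ (inj₂ (x∈p∩q⁺ (x∈p∩q⁺ (z∈W , C⊆S z∈C) , z∈C)))
    ... | no z∉W  = x∈p∪q⁺ (inj₁ (x∈p∩q⁺ (x∉p⇒x∈∁p z∉W , C⊆S z∈C)))

    ⊤⊆ : ⊤ ⊆ ∁ W ∪ (W ∪ S)
    ⊤⊆ {z} _ with z ∈? W
    ... | yes z∈W = x∈p∪q⁺ (inj₂ (x∈p∪q⁺ (inj₁ z∈W)))
    ... | no z∉W  = x∈p∪q⁺ (inj₁ (x∉p⇒x∈∁p z∉W))

    A∪C-bound : r (A ∪ C) + r ((W ∩ S) ∩ C) ≤ r (W ∩ S) + r C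
    A∪C-bound = ≤-trans (+-monoˡ-≤ _ (rank-mono M (∪-least (⊆-trans A⊆ (p⊆p∪q C)) (q⊆p∪q _ C))))
                        (rank-submod M (W ∩ S) C)

    B∪C-bound : r (B ∪ C) ≤ r (∁ W ∩ S) + r ((W ∩ S) ∩ C)
    B∪C-bound = ≤-trans (rank-mono M (∪-least (⊆-trans B⊆ (p⊆p∪q _)) C⊆sides))
                        (≤-trans (m≤m+n _ _) (rank-submod M (∁ W ∩ S) ((W ∩ S) ∩ C)))

    ⊤-bound : r ⊤ + r (∁ W ∩ S) ≤ r (∁ W) + r (W ∪ S)
    ⊤-bound = ≤-trans
      (+-mono-≤ (rank-mono M ⊤⊆) (rank-mono M (∩-greatest (p∩q⊆p _ _) (⊆-trans (p∩q⊆q _ _) (q⊆p∪q W S)))))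
      (rank-submod M (∁ W) (W ∪ S))

    linear-combination : ∀ a b e c s w w′ d u p q →
      a + d ≤ p + c → b ≤ q + d → u + p ≤ w + s → e + q ≤ w′ + u → a + b + e ≤ c + s + (w + w′)
    linear-combination a b e c s w w′ d u p q h₁ h₂ h₃ h₄ =
      +-cancelʳ-≤ (d + u + p + q) _ _
        (subst₂ _≤_ (lhs a b e d u p q) (rhs c s w w′ d u p q) (+-mono-≤ (+-mono-≤ (+-mono-≤ h₁ h₂) h₃) h₄))
      where
      lhs : ∀ a b e d u p q → a + d + b + (u + p) + (e + q) ≡ a + b + e + (d + u + p + q)
      lhs = solve-∀
      rhs : ∀ c s w w′ d u p q → p + c + (q + d) + (w + s) + (w′ + u) ≡ c + s + (w + w′) + (d + u + p + q)
      rhs = solve-∀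

∸-≤-∸ : ∀ x y z e → x + e ≤ y + z → x ∸ y ≤ z ∸ e
∸-≤-∸ x y z e x+e≤y+z = begin
  x ∸ y             ≤⟨ ∸-monoˡ-≤ y (m+n≤o⇒m≤o∸n x x+e≤y+z) ⟩
  y + z ∸ e ∸ y     ≡⟨ ∸-+-assoc (y + z) e y ⟩
  y + z ∸ (e + y)   ≡⟨ cong (y + z ∸_) (+-comm e y) ⟩
  y + z ∸ (y + e)   ≡⟨ [m+n]∸[m+o]≡n∸o y z e ⟩
  z ∸ e             ∎
  where open ≤-Reasoning

∸-contracted-≤ : ∀ {a b c s} e z → c ≤ a → c ≤ b → c ≤ s → a + b + e ≤ c + s + z →
                 (a ∸ c) + (b ∸ c) ∸ (s ∸ c) ≤ z ∸ e
∸-contracted-≤ {c = c} e z c≤a c≤b c≤s ≤sum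
  with m≤n⇒∃[o]m+o≡n c≤a | m≤n⇒∃[o]m+o≡n c≤b | m≤n⇒∃[o]m+o≡n c≤s
... | a , refl | b , refl | s , refl rewrite m+n∸m≡n c a | m+n∸m≡n c b | m+n∸m≡n c s =
  ∸-≤-∸ (a + b) s z e (+-cancelˡ-≤ (c + c) _ _ (subst₂ _≤_ (lhs c a b e) (rhs c s z) ≤sum))
  where
  lhs : ∀ c a b e → c + a + (c + b) + e ≡ c + c + (a + b + e)
  lhs = solve-∀
  rhs : ∀ c s z → c + (c + s) + z ≡ c + c + (s + z)
  rhs = solve-∀

conn-minor-≤ : ∀ {N : Matroid m} {M : Matroid n} {f : Fin m → Fin n} {C} →
               (∀ X → rank N X ≡ rank M (img f X ∪ C) ∸ rank M C) →
               ∀ {X W} → (∀ {x} → x ∈ X → f x ∈ W) → (∀ {x} → x ∉ X → f x ∉ W) → conn N X ≤ conn M W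
conn-minor-≤ {N = N} {M} {f} {C} rank-N {X} {W} X⊆W ∁X⊆∁W = begin
  conn N X                                    ≡⟨ cong₂ _∸_ (cong₂ _+_ (rank-N X) (rank-N (∁ X))) (rank-N ⊤) ⟩
  r (A ∪ C) ∸ r C + (r (B ∪ C) ∸ r C) ∸ (r S ∸ r C)
    ≤⟨ ∸-contracted-≤ (r ⊤) (r W + r (∁ W)) (rank-mono M (q⊆p∪q A C)) (rank-mono M (q⊆p∪q B C))
                      (rank-mono M (q⊆p∪q _ C)) (rank-separated-≤ M A⊆ B⊆ (q⊆p∪q _ C)) ⟩
  conn M W                                    ∎
  where
  open ≤-Reasoning
  r = rank M
  A = img f X
  B = img f (∁ X)
  S = img f ⊤ ∪ C

  f∈S : ∀ {x} → f x ∈ S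
  f∈S = x∈p∪q⁺ (inj₁ (img⁺ f ∈⊤))

  A⊆ : A ⊆ W ∩ S
  A⊆ = img-⊆ f λ x∈X → x∈p∩q⁺ (X⊆W x∈X , f∈S)

  B⊆ : B ⊆ ∁ W ∩ S
  B⊆ = img-⊆ f λ x∈∁X → x∈p∩q⁺ (x∉p⇒x∈∁p (∁X⊆∁W (x∈∁p⇒x∉p x∈∁X)) , f∈S)

injective-missing⇒< : ∀ {f : Fin m → Fin n} → Injective _≡_ _≡_ f → ∀ {y} → (∀ i → f i ≢ y) → m < n
injective-missing⇒< {m} {n} {f} f-inj {y} y-missed = injective⇒≤ {f = f′} f′-inj
  where
  f′ : Fin (suc m) → Fin n
  f′ zero    = y
  f′ (suc i) = f i

  f′-inj : Injective _≡_ _≡_ f′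
  f′-inj {zero}  {zero}  _  = refl
  f′-inj {zero}  {suc j} eq = contradiction (sym eq) (y-missed j)
  f′-inj {suc i} {zero}  eq = contradiction eq (y-missed i)
  f′-inj {suc i} {suc j} eq = cong suc (f-inj eq)

UnionOfComponents : Tree t → (Fin m → Fin t) → Fin t → Subset m → Set
UnionOfComponents Tr τ v X = ∀ e e′ → SameComp Tr v (τ e) (τ e′) → e ∈ X → e′ ∈ X

module _ {M : Matroid n} (D : Decomposition M) (f : Fin m → Fin n) (v : Fin (size D)) (X : Subset m) where

  Meets : Fin n → Set
  Meets e = ∃ λ x → x ∈ X × SameComp (tree D) v (σ D e) (σ D (f x))

  meets? : ∀ e → Dec (Meets e)
  meets? e = any? λ x → x ∈? X ×-dec reachable? (adjMinus (tree D) v) (σ D e) (σ D (f x))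

  partsMeeting : Subset n
  partsMeeting = tabulate λ e → ⌊ meets? e ⌋

  partsMeeting⁺ : ∀ {e} → Meets e → e ∈ partsMeeting
  partsMeeting⁺ {e} meets = ∈-tabulate⁺ {p = λ e → ⌊ meets? e ⌋} (fromWitness {a? = meets? e} meets)

  partsMeeting⁻ : ∀ {e} → e ∈ partsMeeting → Meets e
  partsMeeting⁻ {e} e∈ = toWitness {a? = meets? e} (∈-tabulate⁻ {p = λ e → ⌊ meets? e ⌋} e∈)

  partsMeeting-union : UnionOfParts D v partsMeeting
  partsMeeting-union e e′ (k , w) e∈ with partsMeeting⁻ e∈
  ... | x , x∈X , (l , w′) = partsMeeting⁺ (x , x∈X , _ , Walk-reverse (adjMinus-sym (tree D) v) w ++ʷ w′)

  partsMeeting-⊇ : ∀ {x} → x ∈ X → f x ∈ partsMeeting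
  partsMeeting-⊇ {x} x∈X = partsMeeting⁺ (x , x∈X , 0 , here)

  partsMeeting-∌ : UnionOfComponents (tree D) (σ D ∘ f) v X → ∀ {x} → x ∉ X → f x ∉ partsMeeting
  partsMeeting-∌ X-union {x} x∉X fx∈ with partsMeeting⁻ fx∈
  ... | x′ , x′∈X , (k , w) = x∉X (X-union x′ x (k , Walk-reverse (adjMinus-sym (tree D) v) w) x′∈X)

module _ {m} (N : Matroid (2 + m)) (b : ℕ) where

  -- Like a Decomposition of N, except that some leaves may be unlabelled.
  record PartialDecomposition (t : ℕ) : Set where
    field
      tr     : Tree t
      τ      : Fin (2 + m) → Fin t
      τ-inj  : Injective _≡_ _≡_ τ
      τ-leaf : ∀ e → IsLeaf tr (τ e)
      3≤size : 3 ≤ t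
      width  : ∀ v → IsInternal tr v → ∀ X → UnionOfComponents tr τ v X → conn N X ≤ b
      radius : ∃ λ c → Centre tr c b

  open PartialDecomposition

  restrict : ∀ {M : Matroid n} → IsMinor N M → (D : Decomposition M) → Width≤ D b → Radius≤ D b →
             PartialDecomposition (size D)
  restrict {M = M} (f , C , f-inj , _ , rank-N) D D-width D-radius = record
    { tr     = tree D
    ; τ      = σ D ∘ f
    ; τ-inj  = f-inj ∘ σ-inj D
    ; τ-leaf = σ-leaf D ∘ f
    ; 3≤size = 3≤size′
    ; width  = λ v v-int X X-union →
        ≤-trans (conn-minor-≤ {N = N} {M = M} {C = C} rank-N (partsMeeting-⊇ D f v X) (partsMeeting-∌ D f v X X-union))
                (D-width v v-int _ (partsMeeting-union D f v X))
    ; radius = D-radius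
    }
    where
    3≤size′ : 3 ≤ size D
    3≤size′ with internal D
    ... | v , v-int = ≤-trans (s≤s (s≤s (s≤s z≤n)))
      (injective-missing⇒< (f-inj ∘ σ-inj D) λ e eq → v-int (subst (IsLeaf (tree D)) eq (σ-leaf D (f e))))

  pruneLeaf : (P : PartialDecomposition (suc t)) → ∀ x → IsLeaf (tr P) x → (∀ e → τ P e ≢ x) →
              PartialDecomposition t
  pruneLeaf {t} P x x-leaf x-unlabelled = record
    { tr     = removeLeaf Tr x-leaf
    ; τ      = τ′
    ; τ-inj  = λ eq → τ-inj P (punchOut-injective (x≢τ _) (x≢τ _) eq)
    ; τ-leaf = λ e → removeLeaf-leaf Tr x-leaf 3≤t (subst (IsLeaf Tr) (sym (punchIn-τ′ e)) (τ-leaf P e))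
    ; 3≤size = 3≤t
    ; width  = λ v v-int X X-union → width P (punchIn x v) (v-int ∘ removeLeaf-leaf Tr x-leaf 3≤t) X
        λ e e′ same → X-union e e′ (removeLeaf-sameComp Tr x-leaf
          (subst₂ (SameComp Tr (punchIn x v)) (sym (punchIn-τ′ e)) (sym (punchIn-τ′ e′)) same))
    ; radius = removeLeaf-centre Tr x-leaf (proj₂ (radius P))
    }
    where
    Tr = tr P

    x≢τ : ∀ e → x ≢ τ P e
    x≢τ e = x-unlabelled e ∘ sym

    τ′ : Fin (2 + m) → Fin t
    τ′ e = punchOut (x≢τ e)

    punchIn-τ′ : ∀ e → punchIn x (τ′ e) ≡ τ P e
    punchIn-τ′ e = punchIn-punchOut (x≢τ e)

    3≤t : 3 ≤ t
    3≤t with internal-exists Tr (3≤size P)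
    ... | v , v-int = ≤-trans (s≤s (s≤s (s≤s z≤n)))
      (injective-missing⇒< (λ eq → τ-inj P (punchOut-injective (x≢τ _) (x≢τ _) eq)) {punchOut x≢v}
        λ e eq → v-int (subst (IsLeaf Tr) (punchOut-injective (x≢τ e) x≢v eq) (τ-leaf P e)))
      where
      x≢v : x ≢ v
      x≢v x≡v = v-int (subst (IsLeaf Tr) x≡v x-leaf)

  LeavesLabelled : PartialDecomposition t → Set
  LeavesLabelled P = ∀ v → IsLeaf (tr P) v → ∃ λ e → τ P e ≡ v

  prune : PartialDecomposition t → Σ ℕ λ t′ → Σ (PartialDecomposition t′) LeavesLabelled
  prune {zero} P with 3≤size P
  ... | ()
  prune {suc t} P with any? (λ x → (degree (tr P) x ℕ.≟ 1) ×-dec all? (λ e → ¬? (τ P e ≟ x)))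
  ... | yes (x , x-leaf , x-unlabelled) = prune (pruneLeaf P x x-leaf x-unlabelled)
  ... | no ¬unlabelledLeaf = suc t , P , labelled
    where
    labelled : LeavesLabelled P
    labelled v v-leaf with any? (λ e → τ P e ≟ v)
    ... | yes v-labelled = v-labelled
    ... | no ¬v-labelled = contradiction (v , v-leaf , λ e eq → ¬v-labelled (e , eq)) ¬unlabelledLeaf

  decompose : PartialDecomposition t → ∃ λ (D : Decomposition N) → Width≤ D b × Radius≤ D b
  decompose P with prune P
  ... | t′ , P′ , labelled = D , width P′ , radius P′
    where
    D : Decomposition N
    D = record
      { size     = t′
      ; tree     = tr P′
      ; σ        = τ P′
      ; σ-inj    = τ-inj P′
      ; σ-leaf   = τ-leaf P′
      ; σ-onto   = labelled
      ; internal = internal-exists (tr P′) (3≤size P′)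
      }

proposition5p3 : ∀ {m n} (N : Matroid m) (M : Matroid n) → IsMinor N M →
    ∀ a b → IsBranchDepth N a → IsBranchDepth M b → a ≤ b
proposition5p3 N M _ a b (inj₁ (_ , refl)) _ = z≤n
proposition5p3 N M (f , _ , f-inj , _) a b (inj₂ (2≤m , _)) (inj₁ (n<2 , _)) =
  contradiction (≤-trans n<2 (≤-trans 2≤m (injective⇒≤ f-inj))) (<-irrefl refl)
proposition5p3 N M N≼M a b (inj₂ (s≤s (s≤s _) , _ , a-minimal)) (inj₂ (_ , (D , D-width , D-radius) , _)) =
  a-minimal b (decompose N b (restrict N b N≼M D D-width D-radius))
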